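{- Let $j,k,p$ be non-negative integers with $1 \le p \le k-j$. A graph $G$ is a cograph minimal $(\infty,k)$-polar obstruction of type $(k-j+2,p)$ if and only if $G \cong K_2 + G'$, where $G'$ is a cograph minimal $(\infty,k-1)$-polar obstruction of type $(k-j+1,p)$ which is a $(1,k)$-polar graph.
   Context: All graphs are finite and simple. A cograph is a graph with no induced subgraph isomorphic to $P_4$. $G+H$ denotes disjoint union. A component is trivial if it is isomorphic to $K_1$. A cluster is a disjoint union of complete graphs. For $s,k \in \mathbb{Z}_{\ge 0}\cup\{\infty\}$, an $(s,k)$-polar partition of $G$ is a partition $(A,B)$ of $V(G)$ (parts may be empty) such that $G[A]$ is a complete multipartite graph with at most $s$ parts and $G[B]$ is a cluster with at most $k$ components; $\infty$ means unbounded. $G$ is $(s,k)$-polar if it has such a partition. A cograph minimal $(s,k)$-polar obstruction is a cograph that is not $(s,k)$-polar but all of whose proper induced subgraphs are $(s,k)$-polar. Such an obstruction has type $(c,i)$ if it has exactly $c$ connected components, exactly $i$ of which are trivial. -}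

module Defs where

open import Data.Nat using (ℕ; zero; suc; _<_; _≟_)
open import Data.Fin using (Fin; zero; suc; splitAt)
import Data.Fin as F
open import Data.Fin.Properties using (all?) renaming (_≟_ to _≟ᶠ_)
open import Data.Bool using (Bool; true; false)
open import Data.Sum using (_⊎_; inj₁; inj₂)
open import Data.Product using (Σ; _×_; _,_; ∃)
open import Data.List using (length; filter)
open import Data.List.Base using () renaming (allFin to allFinL)
open import Relation.Binary.PropositionalEquality using (_≡_; _≢_; refl)
open import Relation.Binary.Construct.Closure.ReflexiveTransitive using (Star)
open import Relation.Nullary using (¬_)
open import Function using (Injective; Surjective)
open import Function.Bundles using (_⇔_)

record Graph : Set where
  field
    n      : ℕ
    adj    : Fin n → Fin n → Bool
    sym    : ∀ x y → adj x y ≡ adj y x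
    irrefl : ∀ x → adj x x ≡ false

open Graph public

V : Graph → Set
V G = Fin (n G)

Adj : (G : Graph) → V G → V G → Set
Adj G x y = adj G x y ≡ true

induced : (G : Graph) {m : ℕ} → (Fin m → V G) → Graph
induced G {m} f = record
  { n = m
  ; adj = λ x y → adj G (f x) (f y)
  ; sym = λ x y → sym G (f x) (f y)
  ; irrefl = λ x → irrefl G (f x) }

record _≅_ (G H : Graph) : Set where
  field
    to       : V G → V H
    from     : V H → V G
    from-to  : ∀ x → from (to x) ≡ x
    to-from  : ∀ y → to (from y) ≡ y
    preserve : ∀ x y → adj G x y ≡ adj H (to x) (to y)

sumAdj : ∀ {a b} → (Fin a → Fin a → Bool) → (Fin b → Fin b → Bool)
       → Fin a ⊎ Fin b → Fin a ⊎ Fin b → Bool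
sumAdj p q (inj₁ x) (inj₁ y) = p x y
sumAdj p q (inj₂ x) (inj₂ y) = q x y
sumAdj p q (inj₁ x) (inj₂ y) = false
sumAdj p q (inj₂ x) (inj₁ y) = false

_⊕_ : Graph → Graph → Graph
G ⊕ H = record
  { n = n G Data.Nat.+ n H
  ; adj = λ x y → sumAdj (adj G) (adj H) (splitAt (n G) x) (splitAt (n G) y)
  ; sym = λ x y → s (splitAt (n G) x) (splitAt (n G) y)
  ; irrefl = λ x → i (splitAt (n G) x) }
  where
  s : ∀ u v → sumAdj (adj G) (adj H) u v ≡ sumAdj (adj G) (adj H) v u
  s (inj₁ x) (inj₁ y) = sym G x y
  s (inj₂ x) (inj₂ y) = sym H x y
  s (inj₁ x) (inj₂ y) = refl
  s (inj₂ x) (inj₁ y) = refl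
  i : ∀ u → sumAdj (adj G) (adj H) u u ≡ false
  i (inj₁ x) = irrefl G x
  i (inj₂ x) = irrefl H x

infixl 6 _⊕_

K₂ : Graph
K₂ = record { n = 2 ; adj = a ; sym = s ; irrefl = i }
  where
  a : Fin 2 → Fin 2 → Bool
  a zero zero = false
  a zero (suc zero) = true
  a (suc zero) zero = true
  a (suc zero) (suc zero) = false
  s : ∀ x y → a x y ≡ a y x
  s zero zero = refl
  s zero (suc zero) = refl
  s (suc zero) zero = refl
  s (suc zero) (suc zero) = refl
  i : ∀ x → a x x ≡ false
  i zero = refl
  i (suc zero) = refl

P4adj : Fin 4 → Fin 4 → Bool
P4adj zero (suc zero) = true
P4adj (suc zero) zero = true
P4adj (suc zero) (suc (suc zero)) = true
P4adj (suc (suc zero)) (suc zero) = true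
P4adj (suc (suc zero)) (suc (suc (suc zero))) = true
P4adj (suc (suc (suc zero))) (suc (suc zero)) = true
P4adj _ _ = false

Cograph : Graph → Set
Cograph G = ¬ (Σ (Fin 4 → V G) λ f → Injective _≡_ _≡_ f ×
                 (∀ x y → adj G (f x) (f y) ≡ P4adj x y))

data Bound : Set where
  fin : ℕ → Bound
  ∞   : Bound

Label : Bound → Set
Label (fin k) = Fin k
Label ∞       = ℕ

-- (A , B) encoded by inA : V G → Bool (true = A, false = B).
-- G[A] complete multipartite with ≤ s parts: a labelling of A by ≤ s part
--   names such that distinct vertices of A are adjacent iff their parts differ.
-- G[B] cluster with ≤ k components: a labelling of B by ≤ k clique names such
--   that distinct vertices of B are adjacent iff they get the same name.
record PolarPartition (G : Graph) (s k : Bound) : Set where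
  field
    inA   : V G → Bool
    part  : (x : V G) → inA x ≡ true → Label s
    clq   : (x : V G) → inA x ≡ false → Label k
    multi : ∀ x y (ax : inA x ≡ true) (ay : inA y ≡ true) → x ≢ y →
            Adj G x y ⇔ (part x ax ≢ part y ay)
    clus  : ∀ x y (bx : inA x ≡ false) (by : inA y ≡ false) → x ≢ y →
            Adj G x y ⇔ (clq x bx ≡ clq y by)

Polar : Graph → Bound → Bound → Set
Polar G s k = PolarPartition G s k

MinimalObstruction : Graph → Bound → Bound → Set
MinimalObstruction G s k =
  Cograph G × ¬ Polar G s k ×
  (∀ {m} (f : Fin m → V G) → Injective _≡_ _≡_ f → m < n G →
     Polar (induced G f) s k)

classSize : ∀ {v c} → (Fin v → Fin c) → Fin c → ℕ
classSize comp ℓ = length (filter (λ x → comp x ≟ᶠ ℓ) (allFinL _))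

-- G has exactly c connected components, exactly i of which are trivial:
-- a surjective labelling of V G by Fin c whose classes are exactly the
-- connected components, with exactly i classes of size 1.
HasType : Graph → ℕ → ℕ → Set
HasType G c i = Σ (V G → Fin c) λ comp →
  Surjective _≡_ _≡_ comp ×
  (∀ x y → (comp x ≡ comp y) ⇔ Star (Adj G) x y) ×
  length (filter (λ ℓ → classSize comp ℓ ≟ 1) (allFinL c)) ≡ i

-- Let G be a minimal (∞,k)-polar obstruction with a trivial component v and two
-- non-trivial components. A polar partition of G - v must have an edge uw in its
-- multipartite side A (otherwise v joins a one-part A), and every vertex of A is u, w
-- or a neighbour of one of them. Hence a non-trivial component C avoiding u lies in the
-- cluster side, where, being connected, it is a single clique. C has no third vertex t:
-- re-inserting t into a partition of G - t, into the clique of a vertex of C lying in B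
-- or as a new part adjacent to the whole of A, would make G polar. So G = K₂ + G′.
-- Removing the K₂ saves exactly one clique, which gives minimality of G′ for k - 1;
-- and in a partition of G minus one vertex of the K₂ the other one is isolated, which
-- forces the multipartite side of G′ to be edgeless. Conversely the same constructions
-- show that K₂ + G′ is a minimal (∞,k)-polar obstruction.

{-# OPTIONS --safe #-}
module Submission where

open import Defs
open import Data.Nat using (ℕ; _≤_; _∸_; _+_)
open import Data.Product using (Σ; _×_)
open import Function.Bundles using (_⇔_)

import Data.Nat.Properties as ℕ
open import Algebra.Properties.CommutativeMonoid.Sum ℕ.+-0-commutativeMonoid using (sum; sum-remove; sum-permute)
open import Data.Bool using (Bool; true; false; not; if_then_else_)
import Data.Bool as Bool
open import Data.Bool.Properties using (¬-not)
open import Data.Empty using (⊥; ⊥-elim)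
open import Data.Fin using (Fin; zero; suc; punchIn; punchOut; toℕ)
import Data.Fin.Properties as Fin
open import Data.Fin.Permutation using (permutation)
open import Data.List using (length; filter; tabulate)
open import Data.Nat using (zero; suc; pred; _<_; _⊔_; z≤n; s≤s; s≤s⁻¹)
open import Data.Product using (∃; ∃₂; _,_; proj₁; proj₂)
open import Data.Sum using (_⊎_; inj₁; inj₂)
open import Data.Unit using (⊤; tt)
open import Data.Vec.Functional using (updateAt)
open import Data.Vec.Functional.Properties using (updateAt-updates; updateAt-minimal)
open import Function using (_∘_; Injective; Surjective)
open import Function.Bundles using (mk⇔; module Equivalence)
import Function.Properties.Equivalence as ⇔
open import Function.Related.TypeIsomorphisms using (¬-cong-⇔)
open import Relation.Binary.Construct.Closure.Reflexive using (ReflClosure; refl; [_])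
open import Relation.Binary.Construct.Closure.ReflexiveTransitive as Star using (Star; ε; _◅_)
open import Relation.Binary.PropositionalEquality as ≡ using (_≡_; _≢_; refl; cong; subst; subst₂)
open import Relation.Nullary using (¬_; ¬?; Dec; yes; no; does; contradiction)
import Relation.Nullary.Decidable as Dec
open import Relation.Nullary.Decidable using (_×-dec_; decidable-stable; dec-true; dec-false; does-⇔)
open import Relation.Unary using (Decidable; U)

open Equivalence using (to; from)

true-does : ∀ {A : Set} (a? : Dec A) → does a? ≡ true → A
true-does (yes a) _ = a

count : ∀ {N} → (Fin N → Bool) → ℕ
count f = sum (λ x → if f x then 1 else 0)

length-filter-tabulate : ∀ {N} {A : Set} {P : A → Set} (P? : Decidable P) (g : Fin N → A) →
  length (filter P? (tabulate g)) ≡ count (λ x → does (P? (g x)))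
length-filter-tabulate {zero} P? g = refl
length-filter-tabulate {suc N} P? g with does (P? (g zero))
... | true = cong suc (length-filter-tabulate P? (g ∘ suc))
... | false = length-filter-tabulate P? (g ∘ suc)

count-cong : ∀ {N} {f g : Fin N → Bool} → (∀ x → f x ≡ g x) → count f ≡ count g
count-cong {zero} f≗g = refl
count-cong {suc N} f≗g = ≡.cong₂ (λ b m → (if b then 1 else 0) + m) (f≗g zero) (count-cong (f≗g ∘ suc))

count-remove : ∀ {N} (f : Fin (suc N) → Bool) x → count f ≡ (if f x then 1 else 0) + count (f ∘ punchIn x)
count-remove f x = sum-remove {i = x} (λ y → if f y then 1 else 0)

count-permute : ∀ {M N} (f : Fin N → Bool) (σ : Fin M → Fin N) (σ⁻¹ : Fin N → Fin M) →
  (∀ x → σ (σ⁻¹ x) ≡ x) → (∀ y → σ⁻¹ (σ y) ≡ y) → count (f ∘ σ) ≡ count f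
count-permute f σ σ⁻¹ inv inv′ =
  ≡.sym (sum-permute (λ x → if f x then 1 else 0) (permutation σ σ⁻¹ inv inv′))

count-witness : ∀ {N} (f : Fin N → Bool) → 1 ≤ count f → ∃ λ x → f x ≡ true
count-witness {suc N} f 1≤count with f zero in fzero
... | true = zero , fzero
... | false = let x , fx = count-witness (f ∘ suc) 1≤count in suc x , fx

count-remove-true : ∀ {N} (f : Fin (suc N) → Bool) {x} → f x ≡ true → count f ≡ suc (count (f ∘ punchIn x))
count-remove-true f {x} fx rewrite count-remove f x | fx = refl

count-witnesses : ∀ {N} (f : Fin N → Bool) → 2 ≤ count f → ∃₂ λ x y → x ≢ y × f x ≡ true × f y ≡ true
count-witnesses {suc N} f 2≤count
  with x , fx ← count-witness f (ℕ.≤-trans (s≤s z≤n) 2≤count)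
  with y , fy ← count-witness (f ∘ punchIn x) (s≤s⁻¹ (subst (2 ≤_) (count-remove-true f fx) 2≤count))
  = x , punchIn x y , (Fin.punchInᵢ≢i x y ∘ ≡.sym) , fx , fy

count-≥1 : ∀ {N} (f : Fin N → Bool) {x} → f x ≡ true → 1 ≤ count f
count-≥1 {suc N} f fx rewrite count-remove-true f fx = s≤s z≤n

count-≥2 : ∀ {N} (f : Fin N → Bool) {x y} → f x ≡ true → f y ≡ true → x ≢ y → 2 ≤ count f
count-≥2 {suc N} f fx fy x≢y rewrite count-remove-true f fx =
  s≤s (count-≥1 (f ∘ punchIn _) (≡.trans (cong f (Fin.punchIn-punchOut x≢y)) fy))

count-false : ∀ N → count {N} (λ _ → false) ≡ 0
count-false zero = refl
count-false (suc N) = count-false N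

count-complement : ∀ {N} (f : Fin N → Bool) → count f + count (not ∘ f) ≡ N
count-complement {zero} f = refl
count-complement {suc N} f with f zero
... | true = cong suc (count-complement (f ∘ suc))
... | false = ≡.trans (ℕ.+-suc (count (f ∘ suc)) _) (cong suc (count-complement (f ∘ suc)))

skip : ∀ {N} → Fin N → Fin (pred N) → Fin N
skip {suc N} z = punchIn z

skip-injective : ∀ {N} (z : Fin N) → Injective _≡_ _≡_ (skip z)
skip-injective {suc N} z = Fin.punchIn-injective z _ _

skip-≢ : ∀ {N} (z : Fin N) i → skip z i ≢ z
skip-≢ {suc N} z = Fin.punchInᵢ≢i z

skip-< : ∀ {N} → Fin N → pred N < N
skip-< {suc N} _ = ℕ.≤-refl

unskip : ∀ {N} (z x : Fin N) → x ≢ z → Fin (pred N)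
unskip {suc N} z x x≢z = punchOut (x≢z ∘ ≡.sym)

skip-unskip : ∀ {N} (z x : Fin N) (x≢z : x ≢ z) → skip z (unskip z x x≢z) ≡ x
skip-unskip {suc N} z x x≢z = Fin.punchIn-punchOut _

removeLabel : ℕ → ℕ → ℕ
removeLabel zero c = pred c
removeLabel (suc L) zero = zero
removeLabel (suc L) (suc c) = suc (removeLabel L c)

removeLabel-< : ∀ {L c m} → c ≢ L → c < suc m → L < suc m → removeLabel L c < m
removeLabel-< {zero} {zero} c≢L _ _ = contradiction refl c≢L
removeLabel-< {zero} {suc c} _ (s≤s c<m) _ = c<m
removeLabel-< {suc L} {zero} {suc m} _ _ _ = s≤s z≤n
removeLabel-< {suc L} {suc c} {suc m} c≢L (s≤s c<) (s≤s L<) = s≤s (removeLabel-< (c≢L ∘ cong suc) c< L<)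
removeLabel-< {suc L} {_} {zero} _ _ (s≤s ())

removeLabel-injective : ∀ L {a b} → a ≢ L → b ≢ L → removeLabel L a ≡ removeLabel L b → a ≡ b
removeLabel-injective zero {zero} a≢L _ _ = contradiction refl a≢L
removeLabel-injective zero {suc a} {zero} _ b≢L _ = contradiction refl b≢L
removeLabel-injective zero {suc a} {suc b} _ _ eq = cong suc eq
removeLabel-injective (suc L) {zero} {zero} _ _ _ = refl
removeLabel-injective (suc L) {suc a} {suc b} a≢L b≢L eq =
  cong suc (removeLabel-injective L (a≢L ∘ cong suc) (b≢L ∘ cong suc) (ℕ.suc-injective eq))

Image : ∀ {A B : Set} → (A → B) → B → Set
Image f y = ∃ λ x → f x ≡ y

skip-image : ∀ {N} (z x : Fin N) → x ≢ z → Image (skip z) x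
skip-image z x x≢z = unskip z x x≢z , skip-unskip z x x≢z

∃-missing : ∀ {m N} (f : Fin m → Fin N) → m < N → ∃ λ z → ¬ Image f z
∃-missing {m} {N} f m<N with Fin.all? (λ z → Fin.any? (λ i → f i Fin.≟ z))
... | yes onto = contradiction (Fin.injective⇒≤ section-injective) (ℕ.<⇒≱ m<N)
  where
  section-injective : Injective _≡_ _≡_ (λ z → proj₁ (onto z))
  section-injective {z} {z′} eq = ≡.trans (≡.sym (proj₂ (onto z))) (≡.trans (cong f eq) (proj₂ (onto z′)))
... | no ¬onto = Fin.¬∀⟶∃¬ N _ (λ z → Fin.any? (λ i → f i Fin.≟ z)) ¬onto

∃-fresh : ∀ {N} (f : Fin N → ℕ) → ∃ λ L → ∀ x → L ≢ f x
∃-fresh f = let L , f<L = bound f in L , λ x → ℕ.>⇒≢ (f<L x)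
  where
  bound : ∀ {N} (f : Fin N → ℕ) → ∃ λ L → ∀ x → f x < L
  bound {zero} f = 0 , λ ()
  bound {suc N} f = suc (f zero) ⊔ L , λ where
      zero → ℕ.m≤m⊔n (suc (f zero)) L
      (suc x) → ℕ.≤-trans (f<L x) (ℕ.m≤n⊔m (suc (f zero)) L)
    where
    L = proj₁ (bound (f ∘ suc))
    f<L = proj₂ (bound (f ∘ suc))

complement₂ : ∀ {N} (a b : Fin N) → b ≢ a →
  Σ (Fin (pred (pred N)) → Fin N) λ e → Injective _≡_ _≡_ e × (∀ i → e i ≢ a) × (∀ i → e i ≢ b) ×
                                          (∀ x → x ≢ a → x ≢ b → Image e x)
complement₂ a b b≢a = e , e-injective , e-≢a , e-≢b , e-image
  where
  b′ = unskip a b b≢a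
  e = skip a ∘ skip b′
  e-injective : Injective _≡_ _≡_ e
  e-injective = skip-injective b′ ∘ skip-injective a
  e-≢a : ∀ i → e i ≢ a
  e-≢a i = skip-≢ a _
  e-≢b : ∀ i → e i ≢ b
  e-≢b i ei≡b = skip-≢ b′ i (skip-injective a (≡.trans ei≡b (≡.sym (skip-unskip a b b≢a))))
  e-image : ∀ x → x ≢ a → x ≢ b → Image e x
  e-image x x≢a x≢b = i , ≡.trans (cong (skip a) (skip-unskip b′ x′ x′≢b′)) (skip-unskip a x x≢a)
    where
    x′ = unskip a x x≢a
    x′≢b′ : x′ ≢ b′
    x′≢b′ eq = x≢b (≡.trans (≡.sym (skip-unskip a x x≢a)) (≡.trans (cong (skip a) eq) (skip-unskip a b b≢a)))
    i = unskip b′ x′ x′≢b′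

≡-⇔ : ∀ {A : Set} {a b a′ b′ : A} → a ≡ a′ → b ≡ b′ → (a ≡ b) ⇔ (a′ ≡ b′)
≡-⇔ refl refl = ⇔.refl

≡-swap : ∀ {A : Set} {a b : A} → (a ≡ b) ⇔ (b ≡ a)
≡-swap = mk⇔ ≡.sym ≡.sym

Adj-sym : ∀ (G : Graph) {x y} → Adj G x y → Adj G y x
Adj-sym G {x} {y} xy = ≡.trans (sym G y x) xy

Adj⇒≢ : ∀ (G : Graph) {x y} → Adj G x y → x ≢ y
Adj⇒≢ G {x} xy refl with ≡.trans (≡.sym xy) (irrefl G x)
... | ()

Adj⇔-sym : ∀ (G : Graph) {x y} {A B : Set} → Adj G x y ⇔ A → A ⇔ B → Adj G y x ⇔ B
Adj⇔-sym G xy⇔A A⇔B = ⇔.trans (mk⇔ (Adj-sym G) (Adj-sym G)) (⇔.trans xy⇔A A⇔B)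

Near : (G : Graph) → V G → V G → Set
Near G = ReflClosure (Adj G)

Connected : (G : Graph) → V G → V G → Set
Connected G = Star (Adj G)

Connected-sym : ∀ (G : Graph) {x y} → Connected G x y → Connected G y x
Connected-sym G = Star.reverse (Adj-sym G)

Isolated : (G : Graph) → V G → Set
Isolated G v = ∀ y → ¬ Adj G v y

Near⇒Connected : ∀ (G : Graph) {x y} → Near G x y → Connected G x y
Near⇒Connected G refl = ε
Near⇒Connected G [ xy ] = xy ◅ ε

Connected-isolated : ∀ (G : Graph) {v x} → Isolated G v → Connected G v x → x ≡ v
Connected-isolated G iso ε = refl
Connected-isolated G iso (vy ◅ _) = ⊥-elim (iso _ vy)

infix 4 _↪_

record _↪_ (H G : Graph) : Set where
  field
    embed : V H → V G
    embed-injective : Injective _≡_ _≡_ embed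
    embed-adj : ∀ x y → adj H x y ≡ adj G (embed x) (embed y)

open _↪_

induced-↪ : ∀ (G : Graph) {m} (f : Fin m → V G) → Injective _≡_ _≡_ f → induced G f ↪ G
induced-↪ G f f-injective = record { embed = f ; embed-injective = f-injective ; embed-adj = λ _ _ → refl }

Connected-↪ : ∀ {H G} (e : H ↪ G) {x y} → Connected H x y → Connected G (embed e x) (embed e y)
Connected-↪ e = Star.gmap (embed e) (λ {x} {y} xy → ≡.trans (≡.sym (embed-adj e x y)) xy)

Cograph-↪ : ∀ {H G} → H ↪ G → Cograph G → Cograph H
Cograph-↪ e cograph (f , f-injective , f-P₄) =
  cograph (embed e ∘ f , f-injective ∘ embed-injective e , λ x y → ≡.trans (≡.sym (embed-adj e (f x) (f y))) (f-P₄ x y))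

module _ {G H : Graph} (G≅H : G ≅ H) where
  private module I = _≅_ G≅H

  ≅⇒↪ : G ↪ H
  ≅⇒↪ = record
    { embed = I.to
    ; embed-injective = λ {x} {y} eq → ≡.trans (≡.sym (I.from-to x)) (≡.trans (cong I.from eq) (I.from-to y))
    ; embed-adj = I.preserve }

  ≅-sym : H ≅ G
  ≅-sym = record
    { to = I.from ; from = I.to ; from-to = I.to-from ; to-from = I.from-to
    ; preserve = λ u w → ≡.sym (≡.trans (I.preserve (I.from u) (I.from w)) (≡.cong₂ (adj H) (I.to-from u) (I.to-from w))) }

-- Polar partitions of vertex sets

_<ᴮ_ : ℕ → Bound → Set
m <ᴮ fin s = m < s
m <ᴮ ∞ = ⊤

-- Labels are natural numbers defined on every vertex: Label (fin 0) is empty, so a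
-- vertex could not always carry a junk label for the side it does not belong to.
record PolarOn (G : Graph) (s k : Bound) (S : V G → Set) : Set where
  field
    inA : V G → Bool
    part clique : V G → ℕ
    part-< : ∀ x → S x → inA x ≡ true → part x <ᴮ s
    clique-< : ∀ x → S x → inA x ≡ false → clique x <ᴮ k
    multipartite : ∀ x y → S x → S y → inA x ≡ true → inA y ≡ true → x ≢ y → Adj G x y ⇔ (part x ≢ part y)
    cluster : ∀ x y → S x → S y → inA x ≡ false → inA y ≡ false → x ≢ y → Adj G x y ⇔ (clique x ≡ clique y)

encode : ∀ s → Label s → ℕ
encode (fin _) = toℕ
encode ∞ ℓ = ℓ

encode-< : ∀ s (ℓ : Label s) → encode s ℓ <ᴮ s
encode-< (fin _) = Fin.toℕ<n
encode-< ∞ _ = tt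

decode : ∀ s m → m <ᴮ s → Label s
decode (fin _) m m<s = Data.Fin.fromℕ< m<s
decode ∞ m _ = m

encode-decode : ∀ s m (m<s : m <ᴮ s) → encode s (decode s m m<s) ≡ m
encode-decode (fin _) m m<s = Fin.toℕ-fromℕ< m<s
encode-decode ∞ m _ = refl

encode-≡ : ∀ s {ℓ ℓ′ m m′} → encode s ℓ ≡ m → encode s ℓ′ ≡ m′ → (ℓ ≡ ℓ′) ⇔ (m ≡ m′)
encode-≡ (fin _) refl refl = mk⇔ (cong toℕ) Fin.toℕ-injective
encode-≡ ∞ refl refl = ⇔.refl

when : ∀ (b c : Bool) → (b ≡ c → ℕ) → ℕ
when true true f = f refl
when false false f = f refl
when _ _ _ = 0

when-≡ : ∀ {b c : Bool} (f : b ≡ c → ℕ) (b≡c : b ≡ c) → when b c f ≡ f b≡c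
when-≡ {true} f refl = refl
when-≡ {false} f refl = refl

module _ {G : Graph} {s k : Bound} where

  fromPolar : Polar G s k → PolarOn G s k U
  fromPolar P = record
    { inA = inA
    ; part = part′
    ; clique = clique′
    ; part-< = λ x _ ax → subst (_<ᴮ s) (≡.sym (part′-≡ ax)) (encode-< s _)
    ; clique-< = λ x _ bx → subst (_<ᴮ k) (≡.sym (clique′-≡ bx)) (encode-< k _)
    ; multipartite = λ x y _ _ ax ay x≢y →
        ⇔.trans (multi x y ax ay x≢y) (¬-cong-⇔ (encode-≡ s (≡.sym (part′-≡ ax)) (≡.sym (part′-≡ ay))))
    ; cluster = λ x y _ _ bx by x≢y →
        ⇔.trans (clus x y bx by x≢y) (encode-≡ k (≡.sym (clique′-≡ bx)) (≡.sym (clique′-≡ by)))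
    }
    where
    open PolarPartition P
    part′ clique′ : V G → ℕ
    part′ x = when (inA x) true (encode s ∘ part x)
    clique′ x = when (inA x) false (encode k ∘ clq x)
    part′-≡ : ∀ {x} (ax : inA x ≡ true) → part′ x ≡ encode s (part x ax)
    part′-≡ {x} = when-≡ (encode s ∘ part x)
    clique′-≡ : ∀ {x} (bx : inA x ≡ false) → clique′ x ≡ encode k (clq x bx)
    clique′-≡ {x} = when-≡ (encode k ∘ clq x)

  toPolar : PolarOn G s k U → Polar G s k
  toPolar P = record
    { inA = inA
    ; part = λ x ax → decode s (part x) (part-< x tt ax)
    ; clq = λ x bx → decode k (clique x) (clique-< x tt bx)
    ; multi = λ x y ax ay x≢y →
        ⇔.trans (multipartite x y tt tt ax ay x≢y) (¬-cong-⇔ (⇔.sym (encode-≡ s (encode-decode s _ _) (encode-decode s _ _))))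
    ; clus = λ x y bx by x≢y →
        ⇔.trans (cluster x y tt tt bx by x≢y) (⇔.sym (encode-≡ k (encode-decode k _ _) (encode-decode k _ _)))
    }
    where open PolarOn P

  restrict : ∀ {S T : V G → Set} → (∀ {x} → T x → S x) → PolarOn G s k S → PolarOn G s k T
  restrict T⊆S P = record
    { inA = inA ; part = part ; clique = clique
    ; part-< = λ x → part-< x ∘ T⊆S
    ; clique-< = λ x → clique-< x ∘ T⊆S
    ; multipartite = λ x y tx ty → multipartite x y (T⊆S tx) (T⊆S ty)
    ; cluster = λ x y tx ty → cluster x y (T⊆S tx) (T⊆S ty)
    }
    where open PolarOn P

pullback : ∀ {H G s k S} (e : H ↪ G) → PolarOn G s k S → PolarOn H s k (S ∘ embed e)
pullback {H} {G} e P = record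
  { inA = inA ∘ embed e ; part = part ∘ embed e ; clique = clique ∘ embed e
  ; part-< = part-< ∘ embed e
  ; clique-< = clique-< ∘ embed e
  ; multipartite = λ x y sx sy ax ay x≢y → ⇔.trans (same-adj x y) (multipartite _ _ sx sy ax ay (x≢y ∘ embed-injective e))
  ; cluster = λ x y sx sy bx by x≢y → ⇔.trans (same-adj x y) (cluster _ _ sx sy bx by (x≢y ∘ embed-injective e))
  }
  where
  open PolarOn P
  same-adj : ∀ x y → Adj H x y ⇔ Adj G (embed e x) (embed e y)
  same-adj x y = ≡-⇔ (embed-adj e x y) refl

Polar-≅ : ∀ {G H s k} → G ≅ H → Polar G s k → Polar H s k
Polar-≅ G≅H P = toPolar (pullback (≅⇒↪ (≅-sym G≅H)) (fromPolar P))

polarOn⇒induced : ∀ {G s k S m} (f : Fin m → V G) → Injective _≡_ _≡_ f → (∀ i → S (f i)) →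
  PolarOn G s k S → Polar (induced G f) s k
polarOn⇒induced {G} f f-injective Sf P = toPolar (restrict (λ {i} _ → Sf i) (pullback (induced-↪ G f f-injective) P))

module _ {G : Graph} {m} (f : Fin m → V G) (f-injective : Injective _≡_ _≡_ f) where

  extendAlong : ∀ {A : Set} → A → (Fin m → A) → V G → A
  extendAlong d g x with Fin.any? (λ i → f i Fin.≟ x)
  ... | yes (i , _) = g i
  ... | no _ = d

  extendAlong-f : ∀ {A : Set} (d : A) g i → extendAlong d g (f i) ≡ g i
  extendAlong-f d g i with Fin.any? (λ j → f j Fin.≟ f i)
  ... | yes (j , fj≡fi) = cong g (f-injective fj≡fi)
  ... | no ∄ = contradiction (i , refl) ∄

  pushforward : ∀ {s k} → PolarOn (induced G f) s k U → PolarOn G s k (Image f)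
  pushforward {s} {k} P = record
    { inA = inA′ ; part = part′ ; clique = clique′
    ; part-< = λ { _ (i , refl) ax → subst (_<ᴮ s) (≡.sym (extendAlong-f 0 part i)) (part-< i tt (A-at ax)) }
    ; clique-< = λ { _ (i , refl) bx → subst (_<ᴮ k) (≡.sym (extendAlong-f 0 clique i)) (clique-< i tt (A-at bx)) }
    ; multipartite = λ { _ _ (i , refl) (j , refl) ax ay x≢y →
        ⇔.trans (multipartite i j tt tt (A-at ax) (A-at ay) (x≢y ∘ cong f))
                (¬-cong-⇔ (≡-⇔ (≡.sym (extendAlong-f 0 part i)) (≡.sym (extendAlong-f 0 part j)))) }
    ; cluster = λ { _ _ (i , refl) (j , refl) bx by x≢y →
        ⇔.trans (cluster i j tt tt (A-at bx) (A-at by) (x≢y ∘ cong f))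
                (≡-⇔ (≡.sym (extendAlong-f 0 clique i)) (≡.sym (extendAlong-f 0 clique j))) }
    }
    where
    open PolarOn P
    inA′ = extendAlong true inA
    part′ = extendAlong 0 part
    clique′ = extendAlong 0 clique
    A-at : ∀ {i b} → inA′ (f i) ≡ b → inA i ≡ b
    A-at {i} = ≡.trans (≡.sym (extendAlong-f true inA i))

ProperInducedPolar : Graph → Bound → Bound → Set
ProperInducedPolar G s k = ∀ {m} (f : Fin m → V G) → Injective _≡_ _≡_ f → m < n G → Polar (induced G f) s k

DeletionsPolar : Graph → Bound → Bound → Set
DeletionsPolar G s k = ∀ z → PolarOn G s k (_≢ z)

ProperInducedPolar⇒DeletionsPolar : ∀ {G s k} → ProperInducedPolar G s k → DeletionsPolar G s k
ProperInducedPolar⇒DeletionsPolar polar z =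
  restrict (skip-image z _) (pushforward (skip z) (skip-injective z) (fromPolar (polar (skip z) (skip-injective z) (skip-< z))))

DeletionsPolar⇒ProperInducedPolar : ∀ {G s k} → DeletionsPolar G s k → ProperInducedPolar G s k
DeletionsPolar⇒ProperInducedPolar deletions f f-injective m<n =
  let z , z∉f = ∃-missing f m<n in polarOn⇒induced f f-injective (λ i fi≡z → z∉f (i , fi≡z)) (deletions z)

-- Inserting a vertex into a partition of the others

pairwise-at : ∀ {N} (z : Fin N) (R : Fin N → Fin N → Set) → (∀ {x y} → R x y → R y x) →
  R z z → (∀ y → y ≢ z → R z y) → (∀ x y → x ≢ z → y ≢ z → R x y) → ∀ x y → R x y
pairwise-at z R R-sym Rzz Rz R≢ x y with x Fin.≟ z | y Fin.≟ z
... | yes refl | yes refl = Rzz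
... | yes refl | no y≢z = Rz y y≢z
... | no x≢z | yes refl = R-sym (Rz x x≢z)
... | no x≢z | no y≢z = R≢ x y x≢z y≢z

module _ {G : Graph} {s k : Bound} {S : V G → Set} (z : V G) (P : PolarOn G s k S) where
  open PolarOn P

  private
    in-S : ∀ {x} → x ≡ z ⊎ S x → x ≢ z → S x
    in-S (inj₁ x≡z) x≢z = contradiction x≡z x≢z
    in-S (inj₂ sx) _ = sx

    side-off : ∀ {c b x} → x ≢ z → updateAt inA z (λ _ → c) x ≡ b → inA x ≡ b
    side-off {x = x} x≢z = ≡.trans (≡.sym (updateAt-minimal x z inA x≢z))

    other-side-≢ : ∀ {c x} → updateAt inA z (λ _ → c) x ≡ not c → x ≢ z
    other-side-≢ {true} bx refl with ≡.trans (≡.sym (updateAt-updates z inA)) bx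
    ... | ()
    other-side-≢ {false} ax refl with ≡.trans (≡.sym (updateAt-updates z inA)) ax
    ... | ()

  insertA : ∀ L → L <ᴮ s → (∀ y → S y → inA y ≡ true → Adj G z y ⇔ (L ≢ part y)) →
    PolarOn G s k (λ x → x ≡ z ⊎ S x)
  insertA L L<s z-adj = record
    { inA = inA′ ; part = part′ ; clique = clique
    ; part-< = part′-<
    ; clique-< = λ x mx bx → clique-< x (in-S mx (other-side-≢ bx)) (side-off (other-side-≢ bx) bx)
    ; multipartite = pairwise-at z R R-sym (λ _ _ _ _ z≢z → contradiction refl z≢z) Rz R≢
    ; cluster = λ x y mx my bx by → let x≢z = other-side-≢ bx ; y≢z = other-side-≢ by in
        cluster x y (in-S mx x≢z) (in-S my y≢z) (side-off x≢z bx) (side-off y≢z by)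
    }
    where
    inA′ = updateAt inA z (λ _ → true)
    part′ = updateAt part z (λ _ → L)
    part-at : ∀ {x} → x ≢ z → part′ x ≡ part x
    part-at {x} = updateAt-minimal x z part
    part′-< : ∀ x → x ≡ z ⊎ S x → inA′ x ≡ true → part′ x <ᴮ s
    part′-< x mx ax with x Fin.≟ z
    ... | yes refl = subst (_<ᴮ s) (≡.sym (updateAt-updates z part)) L<s
    ... | no x≢z = subst (_<ᴮ s) (≡.sym (part-at x≢z)) (part-< x (in-S mx x≢z) (side-off x≢z ax))
    R : V G → V G → Set
    R x y = x ≡ z ⊎ S x → y ≡ z ⊎ S y → inA′ x ≡ true → inA′ y ≡ true → x ≢ y →
            Adj G x y ⇔ (part′ x ≢ part′ y)
    R-sym : ∀ {x y} → R x y → R y x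
    R-sym Rxy my mx ay ax y≢x = Adj⇔-sym G (Rxy mx my ax ay (y≢x ∘ ≡.sym)) (¬-cong-⇔ ≡-swap)
    Rz : ∀ y → y ≢ z → R z y
    Rz y y≢z _ my _ ay _ = ⇔.trans (z-adj y (in-S my y≢z) (side-off y≢z ay))
                                   (¬-cong-⇔ (≡-⇔ (≡.sym (updateAt-updates z part)) (≡.sym (part-at y≢z))))
    R≢ : ∀ x y → x ≢ z → y ≢ z → R x y
    R≢ x y x≢z y≢z mx my ax ay x≢y =
      ⇔.trans (multipartite x y (in-S mx x≢z) (in-S my y≢z) (side-off x≢z ax) (side-off y≢z ay) x≢y)
              (¬-cong-⇔ (≡-⇔ (≡.sym (part-at x≢z)) (≡.sym (part-at y≢z))))

  insertB : ∀ L → L <ᴮ k → (∀ y → S y → inA y ≡ false → Adj G z y ⇔ (L ≡ clique y)) →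
    PolarOn G s k (λ x → x ≡ z ⊎ S x)
  insertB L L<k z-adj = record
    { inA = inA′ ; part = part ; clique = clique′
    ; part-< = λ x mx ax → part-< x (in-S mx (other-side-≢ ax)) (side-off (other-side-≢ ax) ax)
    ; clique-< = clique′-<
    ; multipartite = λ x y mx my ax ay → let x≢z = other-side-≢ ax ; y≢z = other-side-≢ ay in
        multipartite x y (in-S mx x≢z) (in-S my y≢z) (side-off x≢z ax) (side-off y≢z ay)
    ; cluster = pairwise-at z R R-sym (λ _ _ _ _ z≢z → contradiction refl z≢z) Rz R≢
    }
    where
    inA′ = updateAt inA z (λ _ → false)
    clique′ = updateAt clique z (λ _ → L)
    clique-at : ∀ {x} → x ≢ z → clique′ x ≡ clique x
    clique-at {x} = updateAt-minimal x z clique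
    clique′-< : ∀ x → x ≡ z ⊎ S x → inA′ x ≡ false → clique′ x <ᴮ k
    clique′-< x mx bx with x Fin.≟ z
    ... | yes refl = subst (_<ᴮ k) (≡.sym (updateAt-updates z clique)) L<k
    ... | no x≢z = subst (_<ᴮ k) (≡.sym (clique-at x≢z)) (clique-< x (in-S mx x≢z) (side-off x≢z bx))
    R : V G → V G → Set
    R x y = x ≡ z ⊎ S x → y ≡ z ⊎ S y → inA′ x ≡ false → inA′ y ≡ false → x ≢ y →
            Adj G x y ⇔ (clique′ x ≡ clique′ y)
    R-sym : ∀ {x y} → R x y → R y x
    R-sym Rxy my mx by bx y≢x = Adj⇔-sym G (Rxy mx my bx by (y≢x ∘ ≡.sym)) ≡-swap
    Rz : ∀ y → y ≢ z → R z y
    Rz y y≢z _ my _ by _ = ⇔.trans (z-adj y (in-S my y≢z) (side-off y≢z by))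
                                   (≡-⇔ (≡.sym (updateAt-updates z clique)) (≡.sym (clique-at y≢z)))
    R≢ : ∀ x y → x ≢ z → y ≢ z → R x y
    R≢ x y x≢z y≢z mx my bx by x≢y =
      ⇔.trans (cluster x y (in-S mx x≢z) (in-S my y≢z) (side-off x≢z bx) (side-off y≢z by) x≢y)
              (≡-⇔ (≡.sym (clique-at x≢z)) (≡.sym (clique-at y≢z)))

PolarOn-total : ∀ {G s k} {z : V G} → PolarOn G s k (λ x → x ≡ z ⊎ x ≢ z) → PolarOn G s k U
PolarOn-total {z = z} = restrict (λ {x} _ → Dec.toSum (x Fin.≟ z))

module _ {G : Graph} {s k : Bound} {S : V G → Set} (P : PolarOn G s k S) where
  open PolarOn P

  A-Edge : Set
  A-Edge = ∃₂ λ u w → S u × S w × inA u ≡ true × inA w ≡ true × Adj G u w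

  A-Edgeless : Set
  A-Edgeless = ∀ u w → S u → S w → inA u ≡ true → inA w ≡ true → ¬ Adj G u w

  A-edge? : Decidable S → A-Edge ⊎ A-Edgeless
  A-edge? S? with Fin.any? (λ u → Fin.any? (λ w →
                    S? u ×-dec S? w ×-dec inA u Bool.≟ true ×-dec inA w Bool.≟ true ×-dec adj G u w Bool.≟ true))
  ... | yes edge = inj₁ edge
  ... | no ∄edge = inj₂ λ u w su sw au aw uw → ∄edge (u , w , su , sw , au , aw , uw)

  A-near-edge : ∀ {u w y} → S u → S w → S y → inA u ≡ true → inA w ≡ true → inA y ≡ true → Adj G u w →
    Near G y u ⊎ Near G y w
  A-near-edge {u} {w} {y} su sw sy au aw ay uw with y Fin.≟ u | adj G y u in yu
  ... | yes refl | _ = inj₁ refl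
  ... | no _ | true = inj₁ [ yu ]
  ... | no y≢u | false with y Fin.≟ w
  ... | yes refl = inj₂ refl
  ... | no y≢w = inj₂ [ from (multipartite y w sy sw ay aw y≢w) (λ py≡pw → pu≢pw (≡.trans (≡.sym py≡pu) py≡pw)) ]
    where
    pu≢pw : part u ≢ part w
    pu≢pw = to (multipartite u w su sw au aw (Adj⇒≢ G uw)) uw
    py≡pu : part y ≡ part u
    py≡pu = decidable-stable (part y ℕ.≟ part u) λ py≢pu →
      contradiction (≡.trans (≡.sym (from (multipartite y u sy su ay au y≢u) py≢pu)) yu) λ ()

  A-connected : ∀ {u w y} → S u → S w → S y → inA u ≡ true → inA w ≡ true → inA y ≡ true → Adj G u w →
    Connected G y u
  A-connected su sw sy au aw ay uw with A-near-edge su sw sy au aw ay uw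
  ... | inj₁ near = Near⇒Connected G near
  ... | inj₂ near = Near⇒Connected G near Star.◅◅ (Adj-sym G uw ◅ ε)

  single-part : A-Edgeless → PolarOn G (fin 1) k S
  single-part edgeless = record
    { inA = inA ; part = λ _ → 0 ; clique = clique
    ; part-< = λ _ _ _ → s≤s z≤n
    ; clique-< = clique-<
    ; multipartite = λ x y sx sy ax ay _ → mk⇔ (⊥-elim ∘ edgeless x y sx sy ax ay) (λ 0≢0 → contradiction refl 0≢0)
    ; cluster = cluster
    }

module _ {G : Graph} {m} {S : V G → Set} (P : PolarOn G ∞ (fin (suc m)) S) where
  open PolarOn P

  drop-unused-clique : ∀ L → L < suc m → (∀ x → S x → inA x ≡ false → clique x ≢ L) → PolarOn G ∞ (fin m) S
  drop-unused-clique L L<1+m unused = record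
    { inA = inA ; part = part ; clique = removeLabel L ∘ clique
    ; part-< = λ _ _ _ → tt
    ; clique-< = λ x sx bx → removeLabel-< (unused x sx bx) (clique-< x sx bx) L<1+m
    ; multipartite = multipartite
    ; cluster = λ x y sx sy bx by x≢y → ⇔.trans (cluster x y sx sy bx by x≢y)
        (mk⇔ (cong (removeLabel L)) (removeLabel-injective L (unused x sx bx) (unused y sy by)))
    }

  -- A clique is complete multipartite with singleton parts, so with A empty the clique labelled 0 can move to A.
  clique-to-A : (∀ x → S x → inA x ≡ false) → PolarOn G ∞ (fin m) S
  clique-to-A all-B = record
    { inA = inA′ ; part = toℕ ; clique = pred ∘ clique
    ; part-< = λ _ _ _ → tt
    ; clique-< = λ x sx bx → removeLabel-< (B-clique bx) (clique-< x sx (all-B x sx)) (s≤s z≤n)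
    ; multipartite = λ x y sx sy ax ay x≢y → mk⇔ (λ _ → x≢y ∘ Fin.toℕ-injective)
        (λ _ → from (cluster x y sx sy (all-B x sx) (all-B y sy) x≢y) (≡.trans (A-clique ax) (≡.sym (A-clique ay))))
    ; cluster = λ x y sx sy bx by x≢y → ⇔.trans (cluster x y sx sy (all-B x sx) (all-B y sy) x≢y)
        (mk⇔ (cong pred) (removeLabel-injective 0 (B-clique bx) (B-clique by)))
    }
    where
    inA′ : V G → Bool
    inA′ x = does (clique x ℕ.≟ 0)
    A-clique : ∀ {x} → inA′ x ≡ true → clique x ≡ 0
    A-clique {x} = true-does (clique x ℕ.≟ 0)
    B-clique : ∀ {x} → inA′ x ≡ false → clique x ≢ 0
    B-clique {x} bx c≡0 = contradiction (≡.trans (≡.sym (dec-true (clique x ℕ.≟ 0) c≡0)) bx) λ ()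

unbounded-parts : ∀ {G k S} → PolarOn G (fin 1) k S → PolarOn G ∞ k S
unbounded-parts P = record
  { inA = inA ; part = part ; clique = clique ; part-< = λ _ _ _ → tt ; clique-< = clique-<
  ; multipartite = multipartite ; cluster = cluster }
  where open PolarOn P

classSize-count : ∀ {N c} (comp : Fin N → Fin c) ℓ → classSize comp ℓ ≡ count (λ x → does (comp x Fin.≟ ℓ))
classSize-count comp ℓ = length-filter-tabulate (λ x → comp x Fin.≟ ℓ) (λ x → x)

trivialClasses : ∀ {N c} → (Fin N → Fin c) → ℕ
trivialClasses comp = count (λ ℓ → does (classSize comp ℓ ℕ.≟ 1))

trivialClasses-cong : ∀ {N N′ c} (comp : Fin N → Fin c) (comp′ : Fin N′ → Fin c) →
  (∀ ℓ → classSize comp ℓ ≡ classSize comp′ ℓ) → trivialClasses comp ≡ trivialClasses comp′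
trivialClasses-cong _ _ same = count-cong (λ ℓ → cong (λ m → does (m ℕ.≟ 1)) (same ℓ))

trivialClasses-punchIn : ∀ {N N′ c} (comp : Fin N → Fin (suc c)) (comp′ : Fin N′ → Fin c) ℓ₀ →
  classSize comp ℓ₀ ≢ 1 → (∀ ℓ → classSize comp (punchIn ℓ₀ ℓ) ≡ classSize comp′ ℓ) →
  trivialClasses comp ≡ trivialClasses comp′
trivialClasses-punchIn comp comp′ ℓ₀ nontrivial sizes = begin
  trivialClasses comp
    ≡⟨ count-remove (λ ℓ → does (classSize comp ℓ ℕ.≟ 1)) ℓ₀ ⟩
  (if does (classSize comp ℓ₀ ℕ.≟ 1) then 1 else 0) + count (λ ℓ → does (classSize comp (punchIn ℓ₀ ℓ) ℕ.≟ 1))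
    ≡⟨ ≡.cong₂ _+_ (cong (λ b → if b then 1 else 0) (dec-false (classSize comp ℓ₀ ℕ.≟ 1) nontrivial))
                   (count-cong (λ ℓ → cong (λ m → does (m ℕ.≟ 1)) (sizes ℓ))) ⟩
  trivialClasses comp′
    ∎
  where open ≡.≡-Reasoning

mkHasType : ∀ {G c i} (comp : V G → Fin c) → (∀ ℓ → Image comp ℓ) →
  (∀ x y → (comp x ≡ comp y) ⇔ Connected G x y) → trivialClasses comp ≡ i → HasType G c i
mkHasType {c = c} comp onto connected trivial =
  comp , onto′ , connected , ≡.trans (length-filter-tabulate (λ ℓ → classSize comp ℓ ℕ.≟ 1) (λ ℓ → ℓ)) trivial
  where
  onto′ : Surjective _≡_ _≡_ comp
  onto′ ℓ = proj₁ (onto ℓ) , λ { refl → proj₂ (onto ℓ) }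

module Components {G c i} (t : HasType G c i) where
  comp : V G → Fin c
  comp = proj₁ t

  onto : ∀ ℓ → Image comp ℓ
  onto ℓ = proj₁ (proj₁ (proj₂ t) ℓ) , proj₂ (proj₁ (proj₂ t) ℓ) refl

  connected : ∀ x y → (comp x ≡ comp y) ⇔ Connected G x y
  connected = proj₁ (proj₂ (proj₂ t))

  trivial : trivialClasses comp ≡ i
  trivial = ≡.trans (≡.sym (length-filter-tabulate (λ ℓ → classSize comp ℓ ℕ.≟ 1) (λ ℓ → ℓ)))
                    (proj₂ (proj₂ (proj₂ t)))

HasType-≅ : ∀ {G H c i} → G ≅ H → HasType G c i → HasType H c i
HasType-≅ {G} {H} G≅H t =
  mkHasType {H} (comp ∘ I.from) onto′ connected′ (≡.trans (trivialClasses-cong (comp ∘ I.from) comp sizes) trivial)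
  where
  open Components {G} t
  module I = _≅_ G≅H
  onto′ : ∀ ℓ → Image (comp ∘ I.from) ℓ
  onto′ ℓ = let x , cx = onto ℓ in I.to x , ≡.trans (cong comp (I.from-to x)) cx
  connected′ : ∀ u w → (comp (I.from u) ≡ comp (I.from w)) ⇔ Connected H u w
  connected′ u w = ⇔.trans (connected (I.from u) (I.from w)) (mk⇔
    (λ c → subst₂ (Connected H) (I.to-from u) (I.to-from w) (Connected-↪ (≅⇒↪ G≅H) c))
    (Connected-↪ (≅⇒↪ (≅-sym G≅H))))
  sizes : ∀ ℓ → classSize (comp ∘ I.from) ℓ ≡ classSize comp ℓ
  sizes ℓ = begin
    classSize (comp ∘ I.from) ℓ            ≡⟨ classSize-count (comp ∘ I.from) ℓ ⟩
    count (λ u → does (comp (I.from u) Fin.≟ ℓ))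
      ≡⟨ count-permute (λ x → does (comp x Fin.≟ ℓ)) I.from I.to I.from-to I.to-from ⟩
    count (λ x → does (comp x Fin.≟ ℓ))    ≡⟨ classSize-count comp ℓ ⟨
    classSize comp ℓ                       ∎
    where open ≡.≡-Reasoning

-- Adding a K₂ component

module K₂⊕ (H : Graph) where

  inH : V H → V (K₂ ⊕ H)
  inH y = suc (suc y)

  inH-↪ : H ↪ K₂ ⊕ H
  inH-↪ = record { embed = inH ; embed-injective = λ { refl → refl } ; embed-adj = λ _ _ → refl }

  Connected-inH : ∀ {y x} → Connected (K₂ ⊕ H) (inH y) x → ∃ λ y′ → x ≡ inH y′ × Connected H y y′
  Connected-inH {y} ε = y , refl , ε
  Connected-inH (_◅_ {j = zero} () _)
  Connected-inH (_◅_ {j = suc zero} () _)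
  Connected-inH (_◅_ {j = suc (suc _)} yz rest) with Connected-inH rest
  ... | y′ , refl , c = y′ , refl , yz ◅ c

  Connected-inH-⇔ : ∀ {y y′} → Connected (K₂ ⊕ H) (inH y) (inH y′) ⇔ Connected H y y′
  Connected-inH-⇔ = mk⇔ (λ c → from-inH (Connected-inH c)) (Connected-↪ inH-↪)
    where
    from-inH : ∀ {y x} → (∃ λ y′ → inH x ≡ inH y′ × Connected H y y′) → Connected H y x
    from-inH (_ , refl , c) = c

  Connected-to-inH : ∀ {x y} → Connected (K₂ ⊕ H) x (inH y) → Image inH x
  Connected-to-inH c = let y′ , x≡y′ , _ = Connected-inH (Connected-sym (K₂ ⊕ H) c) in y′ , ≡.sym x≡y′

  neighbour-of-inH : ∀ {x y} → Adj (K₂ ⊕ H) x (inH y) → Image inH x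
  neighbour-of-inH {suc (suc x)} _ = x , refl

  partner-of-1 : ∀ {x} → Adj (K₂ ⊕ H) (suc zero) x → x ≡ zero
  partner-of-1 {zero} _ = refl
  partner-of-1 {suc zero} ()
  partner-of-1 {suc (suc _)} ()

  middle-in-H : ∀ {x u w} → Adj (K₂ ⊕ H) x u → Adj (K₂ ⊕ H) x w → u ≢ w → Image inH x
  middle-in-H {zero} {suc zero} {suc zero} _ _ u≢w = contradiction refl u≢w
  middle-in-H {suc zero} {zero} {zero} _ _ u≢w = contradiction refl u≢w
  middle-in-H {suc zero} {suc zero} () _ _
  middle-in-H {suc zero} {suc (suc _)} () _ _
  middle-in-H {suc zero} {zero} {suc zero} _ () _
  middle-in-H {suc zero} {zero} {suc (suc _)} _ () _
  middle-in-H {suc (suc x)} _ _ _ = x , refl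

  Cograph-K₂⊕ : Cograph H → Cograph (K₂ ⊕ H)
  Cograph-K₂⊕ cograph (f , f-injective , f-P₄) = cograph (g , g-injective , g-P₄)
    where
    at1 : Image inH (f (suc zero))
    at1 = middle-in-H (f-P₄ _ zero) (f-P₄ _ (suc (suc zero))) (λ f0≡f2 → contradiction (f-injective f0≡f2) λ ())
    at2 : Image inH (f (suc (suc zero)))
    at2 = middle-in-H (f-P₄ _ (suc zero)) (f-P₄ _ (suc (suc (suc zero)))) (λ f1≡f3 → contradiction (f-injective f1≡f3) λ ())
    at : ∀ i → Image inH (f i)
    at zero = neighbour-of-inH (subst (Adj (K₂ ⊕ H) (f zero)) (≡.sym (proj₂ at1)) (f-P₄ _ _))
    at (suc zero) = at1
    at (suc (suc zero)) = at2
    at (suc (suc (suc zero))) = neighbour-of-inH (subst (Adj (K₂ ⊕ H) (f (suc (suc (suc zero))))) (≡.sym (proj₂ at2)) (f-P₄ _ _))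
    g : Fin 4 → V H
    g i = proj₁ (at i)
    g-injective : Injective _≡_ _≡_ g
    g-injective {i} {j} eq = f-injective (≡.trans (≡.sym (proj₂ (at i))) (≡.trans (cong inH eq) (proj₂ (at j))))
    g-P₄ : ∀ i j → adj H (g i) (g j) ≡ P4adj i j
    g-P₄ i j = ≡.trans (≡.cong₂ (adj (K₂ ⊕ H)) (proj₂ (at i)) (proj₂ (at j))) (f-P₄ i j)

  HasType-K₂⊕ : ∀ {c i} → HasType H c i → HasType (K₂ ⊕ H) (suc c) i
  HasType-K₂⊕ {c} t = mkHasType {K₂ ⊕ H} compK ontoK connectedK (≡.trans trivialK trivial)
    where
    open Components {H} t
    compK : V (K₂ ⊕ H) → Fin (suc c)
    compK zero = zero
    compK (suc zero) = zero
    compK (suc (suc y)) = suc (comp y)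
    ontoK : ∀ ℓ → Image compK ℓ
    ontoK zero = zero , refl
    ontoK (suc ℓ) = let y , cy = onto ℓ in inH y , cong suc cy
    K₂-inH : ∀ {x y} {ℓ : Fin c} → compK x ≡ zero → (zero ≡ suc ℓ) ⇔ Connected (K₂ ⊕ H) x (inH y)
    K₂-inH {x} cx = mk⇔ (λ ()) λ c → case-K₂ cx (Connected-to-inH c)
      where
      case-K₂ : ∀ {x} {ℓ : Fin c} → compK x ≡ zero → Image inH x → zero ≡ suc ℓ
      case-K₂ () (_ , refl)
    Connected-⇔-sym : ∀ {x y} → Connected (K₂ ⊕ H) x y ⇔ Connected (K₂ ⊕ H) y x
    Connected-⇔-sym = mk⇔ (Connected-sym (K₂ ⊕ H)) (Connected-sym (K₂ ⊕ H))
    connectedK : ∀ x y → (compK x ≡ compK y) ⇔ Connected (K₂ ⊕ H) x y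
    connectedK zero zero = mk⇔ (λ _ → ε) (λ _ → refl)
    connectedK zero (suc zero) = mk⇔ (λ _ → refl ◅ ε) (λ _ → refl)
    connectedK (suc zero) zero = mk⇔ (λ _ → refl ◅ ε) (λ _ → refl)
    connectedK (suc zero) (suc zero) = mk⇔ (λ _ → ε) (λ _ → refl)
    connectedK zero (suc (suc y)) = K₂-inH refl
    connectedK (suc zero) (suc (suc y)) = K₂-inH refl
    connectedK (suc (suc x)) zero = ⇔.trans ≡-swap (⇔.trans (K₂-inH refl) Connected-⇔-sym)
    connectedK (suc (suc x)) (suc zero) = ⇔.trans ≡-swap (⇔.trans (K₂-inH refl) Connected-⇔-sym)
    connectedK (suc (suc x)) (suc (suc y)) =
      ⇔.trans (mk⇔ Fin.suc-injective (cong suc)) (⇔.trans (connected x y) (⇔.sym Connected-inH-⇔))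
    size-suc : ∀ ℓ → classSize compK (suc ℓ) ≡ classSize comp ℓ
    size-suc ℓ = ≡.trans (classSize-count compK (suc ℓ)) (≡.sym (classSize-count comp ℓ))
    size-zero : classSize compK zero ≡ 2
    size-zero = ≡.trans (classSize-count compK zero) (cong (λ m → suc (suc m)) (count-false (n H)))
    trivialK : trivialClasses compK ≡ trivialClasses comp
    trivialK = trivialClasses-punchIn compK comp zero
                 (λ size≡1 → contradiction (≡.trans (≡.sym size-zero) size≡1) λ ()) size-suc

  HasType-K₂⊕⁻ : ∀ {c i} → HasType (K₂ ⊕ H) (suc c) i → HasType H c i
  HasType-K₂⊕⁻ {c} t = mkHasType {H} comp′ onto′ connected′ (≡.trans trivial′ trivial)
    where
    open Components {K₂ ⊕ H} t
    ℓ₀ = comp zero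
    comp-1 : comp (suc zero) ≡ ℓ₀
    comp-1 = from (connected (suc zero) zero) (refl ◅ ε)
    inH-≢ : ∀ y → comp (inH y) ≢ ℓ₀
    inH-≢ y eq with Connected-to-inH (to (connected zero (inH y)) (≡.sym eq))
    ... | _ , ()
    comp′ : V H → Fin c
    comp′ y = unskip ℓ₀ (comp (inH y)) (inH-≢ y)
    skip-comp′ : ∀ y → skip ℓ₀ (comp′ y) ≡ comp (inH y)
    skip-comp′ y = skip-unskip ℓ₀ (comp (inH y)) (inH-≢ y)
    onto′ : ∀ ℓ → Image comp′ ℓ
    onto′ ℓ with onto (skip ℓ₀ ℓ)
    ... | zero , c0 = contradiction (≡.sym c0) (skip-≢ ℓ₀ ℓ)
    ... | suc zero , c1 = contradiction (≡.trans (≡.sym c1) comp-1) (skip-≢ ℓ₀ ℓ)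
    ... | suc (suc y) , cy = y , skip-injective ℓ₀ (≡.trans (skip-comp′ y) cy)
    connected′ : ∀ y y′ → (comp′ y ≡ comp′ y′) ⇔ Connected H y y′
    connected′ y y′ = ⇔.trans (mk⇔ (cong (skip ℓ₀)) (skip-injective ℓ₀))
      (⇔.trans (≡-⇔ (skip-comp′ y) (skip-comp′ y′)) (⇔.trans (connected (inH y) (inH y′)) Connected-inH-⇔))
    sizes : ∀ ℓ → classSize comp (skip ℓ₀ ℓ) ≡ classSize comp′ ℓ
    sizes ℓ = begin
      classSize comp ℓ′
        ≡⟨ classSize-count comp ℓ′ ⟩
      count (λ x → does (comp x Fin.≟ ℓ′))
        ≡⟨ ≡.cong₂ (λ a b → (if a then 1 else 0) + ((if b then 1 else 0) + count (λ y → does (comp (inH y) Fin.≟ ℓ′))))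
                   (dec-false (comp zero Fin.≟ ℓ′) (skip-≢ ℓ₀ ℓ ∘ ≡.sym))
                   (dec-false (comp (suc zero) Fin.≟ ℓ′) (skip-≢ ℓ₀ ℓ ∘ ≡.sym ∘ ≡.trans (≡.sym comp-1))) ⟩
      count (λ y → does (comp (inH y) Fin.≟ ℓ′))
        ≡⟨ count-cong (λ y → ≡.trans (cong (λ a → does (a Fin.≟ ℓ′)) (≡.sym (skip-comp′ y)))
                                     (does-⇔ skip-≡ (skip ℓ₀ (comp′ y) Fin.≟ ℓ′) (comp′ y Fin.≟ ℓ))) ⟩
      count (λ y → does (comp′ y Fin.≟ ℓ))
        ≡⟨ classSize-count comp′ ℓ ⟨
      classSize comp′ ℓ
        ∎
      where
      open ≡.≡-Reasoning
      ℓ′ = skip ℓ₀ ℓ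
      skip-≡ : ∀ {ℓ″} → (skip ℓ₀ ℓ″ ≡ ℓ′) ⇔ (ℓ″ ≡ ℓ)
      skip-≡ = mk⇔ (skip-injective ℓ₀) (cong (skip ℓ₀))
    ℓ₀-nontrivial : classSize comp ℓ₀ ≢ 1
    ℓ₀-nontrivial size≡1 = contradiction
      (subst (2 ≤_) (≡.trans (≡.sym (classSize-count comp ℓ₀)) size≡1)
        (count-≥2 (λ x → does (comp x Fin.≟ ℓ₀)) {zero} {suc zero} (dec-true (ℓ₀ Fin.≟ ℓ₀) refl)
                  (dec-true (comp (suc zero) Fin.≟ ℓ₀) comp-1) (λ ())))
      λ { (s≤s ()) }
    trivial′ : trivialClasses comp′ ≡ trivialClasses comp
    trivial′ = ≡.sym (trivialClasses-punchIn comp comp′ ℓ₀ ℓ₀-nontrivial sizes)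

  WithK₂ : (V H → Set) → V (K₂ ⊕ H) → Set
  WithK₂ S zero = ⊤
  WithK₂ S (suc zero) = ⊤
  WithK₂ S (suc (suc y)) = S y

  -- The K₂ becomes one new clique.
  PolarOn-K₂⊕ : ∀ {m S} → PolarOn H ∞ (fin m) S → PolarOn (K₂ ⊕ H) ∞ (fin (suc m)) (WithK₂ S)
  PolarOn-K₂⊕ {m} {S} P = record
    { inA = inA′ ; part = part′ ; clique = clique′
    ; part-< = λ _ _ _ → tt
    ; clique-< = clique′-<
    ; multipartite = multipartite′
    ; cluster = cluster′
    }
    where
    open PolarOn P
    inA′ : V (K₂ ⊕ H) → Bool
    inA′ (suc (suc y)) = inA y
    inA′ _ = false
    part′ clique′ : V (K₂ ⊕ H) → ℕ
    part′ (suc (suc y)) = part y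
    part′ _ = 0
    clique′ (suc (suc y)) = clique y
    clique′ _ = m
    clique′-< : ∀ x → WithK₂ S x → inA′ x ≡ false → clique′ x < suc m
    clique′-< zero _ _ = ℕ.≤-refl
    clique′-< (suc zero) _ _ = ℕ.≤-refl
    clique′-< (suc (suc y)) sy by = ℕ.m≤n⇒m≤1+n (clique-< y sy by)
    multipartite′ : ∀ x y → WithK₂ S x → WithK₂ S y → inA′ x ≡ true → inA′ y ≡ true → x ≢ y →
      Adj (K₂ ⊕ H) x y ⇔ (part′ x ≢ part′ y)
    multipartite′ (suc (suc x)) (suc (suc y)) sx sy ax ay x≢y = multipartite x y sx sy ax ay (x≢y ∘ cong inH)
    new-clique : ∀ y → S y → inA y ≡ false → (false ≡ true) ⇔ (m ≡ clique y)
    new-clique y sy by = mk⇔ (λ ()) (λ m≡c → contradiction (≡.sym m≡c) (ℕ.<⇒≢ (clique-< y sy by)))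
    cluster′ : ∀ x y → WithK₂ S x → WithK₂ S y → inA′ x ≡ false → inA′ y ≡ false → x ≢ y →
      Adj (K₂ ⊕ H) x y ⇔ (clique′ x ≡ clique′ y)
    cluster′ zero zero _ _ _ _ x≢y = contradiction refl x≢y
    cluster′ (suc zero) (suc zero) _ _ _ _ x≢y = contradiction refl x≢y
    cluster′ zero (suc zero) _ _ _ _ _ = mk⇔ (λ _ → refl) (λ _ → refl)
    cluster′ (suc zero) zero _ _ _ _ _ = mk⇔ (λ _ → refl) (λ _ → refl)
    cluster′ zero (suc (suc y)) _ sy _ by _ = new-clique y sy by
    cluster′ (suc zero) (suc (suc y)) _ sy _ by _ = new-clique y sy by
    cluster′ (suc (suc x)) zero sx _ bx _ _ = ⇔.trans (new-clique x sx bx) ≡-swap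
    cluster′ (suc (suc x)) (suc zero) sx _ bx _ _ = ⇔.trans (new-clique x sx bx) ≡-swap
    cluster′ (suc (suc x)) (suc (suc y)) sx sy bx by x≢y = cluster x y sx sy bx by (x≢y ∘ cong inH)

  PolarOn-K₂⊕⁻ : ∀ {m S} → PolarOn (K₂ ⊕ H) ∞ (fin (suc m)) S → S zero → S (suc zero) →
    PolarOn H ∞ (fin m) (S ∘ inH)
  PolarOn-K₂⊕⁻ {m} {S} P s0 s1 = by-sides (inA zero) (inA (suc zero)) refl refl
    where
    open PolarOn P
    drop-clique-of : ∀ t → S t → inA t ≡ false → (∀ y → inH y ≢ t) → (∀ y → ¬ Adj (K₂ ⊕ H) (inH y) t) →
      PolarOn H ∞ (fin m) (S ∘ inH)
    drop-clique-of t st bt y≢t ¬adj = drop-unused-clique (pullback inH-↪ P) (clique t) (clique-< t st bt)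
      λ y sy by same → ¬adj y (from (cluster (inH y) t sy st by bt (y≢t y)) same)
    far-from-K₂ : ∀ {y} → Near (K₂ ⊕ H) (inH y) zero ⊎ Near (K₂ ⊕ H) (inH y) (suc zero) → ⊥
    far-from-K₂ (inj₁ [ () ])
    far-from-K₂ (inj₂ [ () ])
    by-sides : ∀ b0 b1 → inA zero ≡ b0 → inA (suc zero) ≡ b1 → PolarOn H ∞ (fin m) (S ∘ inH)
    by-sides false _ b0 _ = drop-clique-of zero s0 b0 (λ _ ()) (λ _ ())
    by-sides true false _ b1 = drop-clique-of (suc zero) s1 b1 (λ _ ()) (λ _ ())
    by-sides true true a0 a1 = clique-to-A (pullback inH-↪ P)
      λ y sy → ¬-not λ ay → far-from-K₂ (A-near-edge P s0 s1 sy a0 a1 ay refl)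

  -- Deleting a vertex of the K₂ isolates its partner t, which can join a one-part A.
  PolarOn-partner : ∀ {k} → PolarOn H (fin 1) k U → ∀ t → (∀ y → ¬ Adj (K₂ ⊕ H) t (inH y)) →
    PolarOn (K₂ ⊕ H) (fin 1) k (λ x → x ≡ t ⊎ Image inH x)
  PolarOn-partner P t t-isolated = insertA t P′ 0 (s≤s z≤n)
    λ y iy ay → mk⇔ (⊥-elim ∘ isolated iy)
                    (λ 0≢p → ⊥-elim (0≢p (≡.sym (ℕ.n<1⇒n≡0 (PolarOn.part-< P′ y iy ay)))))
    where
    P′ = pushforward inH (embed-injective inH-↪) P
    isolated : ∀ {x} → Image inH x → ¬ Adj (K₂ ⊕ H) t x
    isolated (y , refl) = t-isolated y

MinimalObstruction-≅ : ∀ {G H s k} → G ≅ H → MinimalObstruction G s k → MinimalObstruction H s k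
MinimalObstruction-≅ {G} {H} {s} {k} G≅H (cograph , ¬polar , proper) =
  Cograph-↪ H↪G cograph , ¬polar ∘ Polar-≅ (≅-sym G≅H) , DeletionsPolar⇒ProperInducedPolar deletions
  where
  H↪G = ≅⇒↪ (≅-sym G≅H)
  deletions : DeletionsPolar H s k
  deletions u = restrict (λ u′≢u → u′≢u ∘ embed-injective H↪G)
                         (pullback H↪G (ProperInducedPolar⇒DeletionsPolar proper (embed H↪G u)))

module _ {H : Graph} {k : ℕ} where
  open K₂⊕ H

  K₂⊕-obstruction⁻ : MinimalObstruction (K₂ ⊕ H) ∞ (fin (suc k)) → MinimalObstruction H ∞ (fin k)
  K₂⊕-obstruction⁻ (cograph , ¬polar , proper) =
    Cograph-↪ inH-↪ cograph , ¬polar′ , DeletionsPolar⇒ProperInducedPolar deletions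
    where
    ¬polar′ : ¬ Polar H ∞ (fin k)
    ¬polar′ P = ¬polar (toPolar (restrict (λ {x} _ → everywhere x) (PolarOn-K₂⊕ (fromPolar P))))
      where
      everywhere : ∀ x → WithK₂ U x
      everywhere zero = tt
      everywhere (suc zero) = tt
      everywhere (suc (suc _)) = tt
    deletions : DeletionsPolar H ∞ (fin k)
    deletions z = restrict (λ y≢z → y≢z ∘ embed-injective inH-↪)
      (PolarOn-K₂⊕⁻ (ProperInducedPolar⇒DeletionsPolar proper (inH z)) (λ ()) (λ ()))

  -- In G - 0 the vertex 1 is isolated: an A-edge forces 1 into B, and then 0 can join its clique.
  A-edge⇒polar : (P : PolarOn (K₂ ⊕ H) ∞ (fin k) (_≢ zero)) → A-Edge P → Polar (K₂ ⊕ H) ∞ (fin k)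
  A-edge⇒polar P (u , w , su , sw , au , aw , uw) =
    toPolar (PolarOn-total (insertB zero P (clique (suc zero)) (clique-< (suc zero) (λ ()) b1) join))
    where
    open PolarOn P
    not-near-1 : Near (K₂ ⊕ H) (suc zero) u ⊎ Near (K₂ ⊕ H) (suc zero) w → ⊥
    not-near-1 (inj₁ refl) = sw (partner-of-1 uw)
    not-near-1 (inj₁ [ 1u ]) = su (partner-of-1 1u)
    not-near-1 (inj₂ refl) = su (partner-of-1 (Adj-sym (K₂ ⊕ H) {u} {suc zero} uw))
    not-near-1 (inj₂ [ 1w ]) = sw (partner-of-1 1w)
    b1 : inA (suc zero) ≡ false
    b1 = ¬-not λ a1 → not-near-1 (A-near-edge P su sw (λ ()) au aw a1 uw)
    join : ∀ y → y ≢ zero → inA y ≡ false → Adj (K₂ ⊕ H) zero y ⇔ (clique (suc zero) ≡ clique y)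
    join zero 0≢0 _ = contradiction refl 0≢0
    join (suc zero) _ _ = mk⇔ (λ _ → refl) (λ _ → refl)
    join (suc (suc y)) _ by = mk⇔ (λ ())
      (λ same → contradiction (from (cluster (suc zero) (inH y) (λ ()) (λ ()) b1 by (λ ())) same) λ ())

  K₂⊕-obstruction⇒one-part : MinimalObstruction (K₂ ⊕ H) ∞ (fin k) → Polar H (fin 1) (fin k)
  K₂⊕-obstruction⇒one-part (_ , ¬polar , proper) = one-part (ProperInducedPolar⇒DeletionsPolar proper zero)
    where
    one-part : PolarOn (K₂ ⊕ H) ∞ (fin k) (_≢ zero) → Polar H (fin 1) (fin k)
    one-part P with A-edge? P (λ x → ¬? (x Fin.≟ zero))
    ... | inj₁ edge = ⊥-elim (¬polar (A-edge⇒polar P edge))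
    ... | inj₂ edgeless = toPolar (restrict (λ _ ()) (pullback inH-↪ (single-part P edgeless)))

  K₂⊕-obstruction : MinimalObstruction H ∞ (fin k) → Polar H (fin 1) (fin (suc k)) →
    MinimalObstruction (K₂ ⊕ H) ∞ (fin (suc k))
  K₂⊕-obstruction (cograph , ¬polar , proper) polar₁ =
    Cograph-K₂⊕ cograph , (λ P → ¬polar (toPolar (PolarOn-K₂⊕⁻ (fromPolar P) tt tt))) ,
    DeletionsPolar⇒ProperInducedPolar deletions
    where
    avoiding : ∀ {z : V H} (x : V (K₂ ⊕ H)) → x ≢ inH z → WithK₂ (_≢ z) x
    avoiding zero _ = tt
    avoiding (suc zero) _ = tt
    avoiding (suc (suc y)) y≢z = y≢z ∘ cong inH
    deletions : DeletionsPolar (K₂ ⊕ H) ∞ (fin (suc k))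
    deletions zero = restrict (λ {x} → beside-0 x) (unbounded-parts (PolarOn-partner (fromPolar polar₁) (suc zero) (λ _ ())))
      where
      beside-0 : ∀ x → x ≢ zero → x ≡ suc zero ⊎ Image inH x
      beside-0 zero 0≢0 = contradiction refl 0≢0
      beside-0 (suc zero) _ = inj₁ refl
      beside-0 (suc (suc y)) _ = inj₂ (y , refl)
    deletions (suc zero) = restrict (λ {x} → beside-1 x) (unbounded-parts (PolarOn-partner (fromPolar polar₁) zero (λ _ ())))
      where
      beside-1 : ∀ x → x ≢ suc zero → x ≡ zero ⊎ Image inH x
      beside-1 zero _ = inj₁ refl
      beside-1 (suc zero) 1≢1 = contradiction refl 1≢1
      beside-1 (suc (suc y)) _ = inj₂ (y , refl)
    deletions (suc (suc z)) = restrict (λ {x} → avoiding {z} x) (PolarOn-K₂⊕ (ProperInducedPolar⇒DeletionsPolar proper z))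

-- Finding the K₂ component

IsK₂Component : (G : Graph) → V G → V G → Set
IsK₂Component G a b = Adj G a b × (∀ y → Adj G a y → y ≡ b) × (∀ y → Adj G b y → y ≡ a)

module _ {G : Graph} {k : Bound} (¬polar : ¬ Polar G ∞ k) (deletions : DeletionsPolar G ∞ k) where

  -- An isolated vertex could otherwise join a one-part A.
  A-edge-beside-isolated : ∀ v → Isolated G v → A-Edge (deletions v)
  A-edge-beside-isolated v isolated with A-edge? (deletions v) (λ x → ¬? (x Fin.≟ v))
  ... | inj₁ edge = edge
  ... | inj₂ edgeless = ⊥-elim (¬polar (toPolar (PolarOn-total (unbounded-parts
          (insertA v (single-part (deletions v) edgeless) 0 (s≤s z≤n)
            λ y _ _ → mk⇔ (⊥-elim ∘ isolated y) (λ 0≢0 → contradiction refl 0≢0))))))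

  -- The component of a, away from the A-edge uw of G - v, is a clique of size 2.
  module AwayFromA-Edge {v u w a b : V G} (isolated : Isolated G v)
    (su : u ≢ v) (sw : w ≢ v) (au : PolarOn.inA (deletions v) u ≡ true) (aw : PolarOn.inA (deletions v) w ≡ true)
    (uw : Adj G u w) (ab : Adj G a b) (¬au : ¬ Connected G a u) where

    open PolarOn (deletions v)

    C : V G → Set
    C = Connected G a

    C⇒≢v : ∀ {x} → C x → x ≢ v
    C⇒≢v ax refl with Connected-isolated G isolated (Connected-sym G ax)
    ... | refl = isolated b ab

    C⇒B : ∀ {x} → C x → inA x ≡ false
    C⇒B ax = ¬-not λ inA-x → ¬au (ax Star.◅◅ A-connected (deletions v) su sw (C⇒≢v ax) au aw inA-x uw)

    C-clique-label : ∀ {x y} → C x → Connected G x y → clique y ≡ clique x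
    C-clique-label ax ε = refl
    C-clique-label {x} ax (xz ◅ zy) = ≡.trans (C-clique-label az zy)
        (≡.sym (to (cluster x _ (C⇒≢v ax) (C⇒≢v az) (C⇒B ax) (C⇒B az) (Adj⇒≢ G xz)) xz))
      where az = ax Star.◅◅ (xz ◅ ε)

    C-clique : ∀ {x y} → C x → C y → x ≢ y → Adj G x y
    C-clique {x} {y} ax ay x≢y = from (cluster x y (C⇒≢v ax) (C⇒≢v ay) (C⇒B ax) (C⇒B ay) x≢y)
      (≡.trans (C-clique-label (ε {x = a}) ax) (≡.sym (C-clique-label (ε {x = a}) ay)))

    -- A third vertex t of C could be re-inserted into G - t: into the clique of a or b, or as a new part.
    no-third : ∀ {t} → C t → t ≢ a → t ≢ b → ⊥
    no-third {t} at t≢a t≢b = ¬polar (toPolar (PolarOn-total by-sides))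
      where
      module Q = PolarOn (deletions t)
      join : ∀ {c} → C c → c ≢ t → Q.inA c ≡ false →
        ∀ y → y ≢ t → Q.inA y ≡ false → Adj G t y ⇔ (Q.clique c ≡ Q.clique y)
      join {c} ac c≢t bc y y≢t by with y Fin.≟ c
      ... | yes refl = mk⇔ (λ _ → refl) (λ _ → C-clique at ac (c≢t ∘ ≡.sym))
      ... | no y≢c = mk⇔
        (λ ty → to (Q.cluster c y c≢t y≢t bc by (y≢c ∘ ≡.sym)) (C-clique ac (at Star.◅◅ (ty ◅ ε)) (y≢c ∘ ≡.sym)))
        (λ same → C-clique at (ac Star.◅◅ (from (Q.cluster c y c≢t y≢t bc by (y≢c ∘ ≡.sym)) same ◅ ε))
                              (y≢t ∘ ≡.sym))
      fresh = ∃-fresh Q.part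
      by-sides : PolarOn G ∞ k (λ x → x ≡ t ⊎ x ≢ t)
      by-sides with Q.inA a in inA-a | Q.inA b in inA-b
      ... | false | _ = insertB t (deletions t) (Q.clique a) (Q.clique-< a (t≢a ∘ ≡.sym) inA-a) (join ε (t≢a ∘ ≡.sym) inA-a)
      ... | true | false = insertB t (deletions t) (Q.clique b) (Q.clique-< b (t≢b ∘ ≡.sym) inA-b)
                             (join (ab ◅ ε) (t≢b ∘ ≡.sym) inA-b)
      ... | true | true = insertA t (deletions t) (proj₁ fresh) tt λ y y≢t inA-y → mk⇔ (λ _ → proj₂ fresh y)
        (λ _ → C-clique at
          (Connected-sym G (A-connected (deletions t) (t≢a ∘ ≡.sym) (t≢b ∘ ≡.sym) y≢t inA-a inA-b inA-y ab))
                         (y≢t ∘ ≡.sym))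

    isK₂Component : IsK₂Component G a b
    isK₂Component = ab , a-partner , b-partner
      where
      a-partner : ∀ y → Adj G a y → y ≡ b
      a-partner y ay with y Fin.≟ b
      ... | yes y≡b = y≡b
      ... | no y≢b = ⊥-elim (no-third (ay ◅ ε) (Adj⇒≢ G ay ∘ ≡.sym) y≢b)
      b-partner : ∀ y → Adj G b y → y ≡ a
      b-partner y by with y Fin.≟ a
      ... | yes y≡a = y≡a
      ... | no y≢a = ⊥-elim (no-third (ab ◅ by ◅ ε) y≢a (Adj⇒≢ G by ∘ ≡.sym))

  K₂-component : (∀ x y → Dec (Connected G x y)) → ∀ v → Isolated G v →
    ∀ {a₁ b₁ a₂ b₂} → Adj G a₁ b₁ → Adj G a₂ b₂ → ¬ Connected G a₁ a₂ → ∃₂ (IsK₂Component G)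
  K₂-component connected? v isolated {a₁} {b₁} {a₂} {b₂} a₁b₁ a₂b₂ ¬a₁a₂
    with u , w , su , sw , au , aw , uw ← A-edge-beside-isolated v isolated
    with connected? a₁ u
  ... | no ¬a₁u = a₁ , b₁ , AwayFromA-Edge.isK₂Component isolated su sw au aw uw a₁b₁ ¬a₁u
  ... | yes a₁u = a₂ , b₂ , AwayFromA-Edge.isK₂Component isolated su sw au aw uw a₂b₂
                              (λ a₂u → ¬a₁a₂ (a₁u Star.◅◅ Connected-sym G a₂u))

module _ {G : Graph} {a b : V G} (K₂-ab : IsK₂Component G a b) where
  private
    ab = proj₁ K₂-ab
    b≢a = Adj⇒≢ G ab ∘ ≡.sym
    e = proj₁ (complement₂ a b b≢a)
    e-injective = proj₁ (proj₂ (complement₂ a b b≢a))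
    e-≢a = proj₁ (proj₂ (proj₂ (complement₂ a b b≢a)))
    e-≢b = proj₁ (proj₂ (proj₂ (proj₂ (complement₂ a b b≢a))))
    e-image = proj₂ (proj₂ (proj₂ (proj₂ (complement₂ a b b≢a))))
    H = induced G e
    open K₂⊕ H

    data Position (x : V G) : Set where
      at-a : x ≡ a → Position x
      at-b : x ≡ b → Position x
      at-e : ∀ i → e i ≡ x → Position x

    position : ∀ x → Position x
    position x with x Fin.≟ a | x Fin.≟ b
    ... | yes x≡a | _ = at-a x≡a
    ... | no _ | yes x≡b = at-b x≡b
    ... | no x≢a | no x≢b = let i , ei≡x = e-image x x≢a x≢b in at-e i ei≡x

    toK₂⊕ : ∀ {x} → Position x → V (K₂ ⊕ H)
    toK₂⊕ (at-a _) = zero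
    toK₂⊕ (at-b _) = suc zero
    toK₂⊕ (at-e i _) = inH i

    fromK₂⊕ : V (K₂ ⊕ H) → V G
    fromK₂⊕ zero = a
    fromK₂⊕ (suc zero) = b
    fromK₂⊕ (suc (suc i)) = e i

    from-to : ∀ {x} (p : Position x) → fromK₂⊕ (toK₂⊕ p) ≡ x
    from-to (at-a x≡a) = ≡.sym x≡a
    from-to (at-b x≡b) = ≡.sym x≡b
    from-to (at-e i ei≡x) = ei≡x

    to-from : ∀ u (p : Position (fromK₂⊕ u)) → toK₂⊕ p ≡ u
    to-from zero (at-a _) = refl
    to-from zero (at-b a≡b) = contradiction (≡.sym a≡b) b≢a
    to-from zero (at-e i ei≡a) = contradiction ei≡a (e-≢a i)
    to-from (suc zero) (at-a b≡a) = contradiction b≡a b≢a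
    to-from (suc zero) (at-b _) = refl
    to-from (suc zero) (at-e i ei≡b) = contradiction ei≡b (e-≢b i)
    to-from (suc (suc i)) (at-a ei≡a) = contradiction ei≡a (e-≢a i)
    to-from (suc (suc i)) (at-b ei≡b) = contradiction ei≡b (e-≢b i)
    to-from (suc (suc i)) (at-e j ej≡ei) = cong inH (e-injective ej≡ei)

    a-e : ∀ j → adj G a (e j) ≡ false
    a-e j = ¬-not λ a-ej → e-≢b j (proj₁ (proj₂ K₂-ab) _ a-ej)
    b-e : ∀ j → adj G b (e j) ≡ false
    b-e j = ¬-not λ b-ej → e-≢a j (proj₂ (proj₂ K₂-ab) _ b-ej)

    preserve : ∀ {x y} (p : Position x) (q : Position y) → adj G x y ≡ adj (K₂ ⊕ H) (toK₂⊕ p) (toK₂⊕ q)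
    preserve (at-a refl) (at-a refl) = irrefl G a
    preserve (at-a refl) (at-b refl) = ab
    preserve (at-a refl) (at-e j refl) = a-e j
    preserve (at-b refl) (at-a refl) = Adj-sym G ab
    preserve (at-b refl) (at-b refl) = irrefl G b
    preserve (at-b refl) (at-e j refl) = b-e j
    preserve (at-e i refl) (at-a refl) = ≡.trans (sym G (e i) a) (a-e i)
    preserve (at-e i refl) (at-b refl) = ≡.trans (sym G (e i) b) (b-e i)
    preserve (at-e i refl) (at-e j refl) = refl

  K₂-split : Σ Graph λ H → G ≅ (K₂ ⊕ H)
  K₂-split = H , record
    { to = toK₂⊕ ∘ position
    ; from = fromK₂⊕
    ; from-to = from-to ∘ position
    ; to-from = λ u → to-from u (position (fromK₂⊕ u))
    ; preserve = λ x y → preserve (position x) (position y)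
    }

module _ {G : Graph} {c i} (t : HasType G c i) where
  open Components {G} t

  connected? : ∀ x y → Dec (Connected G x y)
  connected? x y = Dec.map (connected x y) (comp x Fin.≟ comp y)

  isolated-vertex : 1 ≤ i → ∃ (Isolated G)
  isolated-vertex 1≤i = v , λ y vy → contradiction
      (subst (2 ≤_) (≡.trans (≡.sym (classSize-count comp ℓ)) size≡1)
        (count-≥2 (λ x → does (comp x Fin.≟ ℓ)) (dec-true (comp v Fin.≟ ℓ) cv)
          (dec-true (comp y Fin.≟ ℓ) (≡.trans (≡.sym (from (connected v y) (vy ◅ ε))) cv)) (Adj⇒≢ G vy)))
      λ { (s≤s ()) }
    where
    trivial-class = count-witness (λ ℓ → does (classSize comp ℓ ℕ.≟ 1)) (subst (1 ≤_) (≡.sym trivial) 1≤i)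
    ℓ = proj₁ trivial-class
    size≡1 = true-does (classSize comp ℓ ℕ.≟ 1) (proj₂ trivial-class)
    v = proj₁ (onto ℓ)
    cv = proj₂ (onto ℓ)

  edge-in-class : ∀ ℓ → classSize comp ℓ ≢ 1 → ∃₂ λ x y → comp x ≡ ℓ × Adj G x y
  edge-in-class ℓ size≢1 = x , proj₁ step , cx , proj₂ step
    where
    member : 1 ≤ count (λ x → does (comp x Fin.≟ ℓ))
    member = count-≥1 (λ x → does (comp x Fin.≟ ℓ)) (dec-true (comp (proj₁ (onto ℓ)) Fin.≟ ℓ) (proj₂ (onto ℓ)))
    two-members = count-witnesses (λ x → does (comp x Fin.≟ ℓ))
      (ℕ.≤∧≢⇒< member (λ 1≡size → size≢1 (≡.trans (classSize-count comp ℓ) (≡.sym 1≡size))))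
    x = proj₁ two-members
    y = proj₁ (proj₂ two-members)
    x≢y = proj₁ (proj₂ (proj₂ two-members))
    cx = true-does (comp x Fin.≟ ℓ) (proj₁ (proj₂ (proj₂ (proj₂ two-members))))
    cy = true-does (comp y Fin.≟ ℓ) (proj₂ (proj₂ (proj₂ (proj₂ two-members))))
    first-step : ∀ {x y} → x ≢ y → Connected G x y → ∃ (Adj G x)
    first-step x≢x ε = contradiction refl x≢x
    first-step _ (xz ◅ _) = _ , xz
    step = first-step x≢y (to (connected x y) (≡.trans cx (≡.sym cy)))

  nontrivial-components : i + 2 ≤ c →
    ∃₂ λ a₁ b₁ → ∃₂ λ a₂ b₂ → Adj G a₁ b₁ × Adj G a₂ b₂ × ¬ Connected G a₁ a₂
  nontrivial-components i+2≤c = a₁ , b₁ , a₂ , b₂ , a₁b₁ , a₂b₂ ,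
    λ a₁a₂ → ℓ₁≢ℓ₂ (≡.trans (≡.sym ca₁) (≡.trans (from (connected a₁ a₂) a₁a₂) ca₂))
    where
    f : Fin c → Bool
    f ℓ = does (classSize comp ℓ ℕ.≟ 1)
    two-nontrivial = count-witnesses (not ∘ f)
      (ℕ.+-cancelˡ-≤ i 2 _ (subst (i + 2 ≤_) (≡.trans (≡.sym (count-complement f)) (cong (_+ count (not ∘ f)) trivial))
                                  i+2≤c))
    nontrivial : ∀ ℓ → not (f ℓ) ≡ true → classSize comp ℓ ≢ 1
    nontrivial ℓ not-fℓ size≡1 =
      contradiction (≡.trans (cong not (≡.sym (dec-true (classSize comp ℓ ℕ.≟ 1) size≡1))) not-fℓ) λ ()
    ℓ₁ = proj₁ two-nontrivial
    ℓ₂ = proj₁ (proj₂ two-nontrivial)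
    ℓ₁≢ℓ₂ = proj₁ (proj₂ (proj₂ two-nontrivial))
    edge₁ = edge-in-class ℓ₁ (nontrivial ℓ₁ (proj₁ (proj₂ (proj₂ (proj₂ two-nontrivial)))))
    edge₂ = edge-in-class ℓ₂ (nontrivial ℓ₂ (proj₂ (proj₂ (proj₂ (proj₂ two-nontrivial)))))
    a₁ = proj₁ edge₁
    b₁ = proj₁ (proj₂ edge₁)
    ca₁ = proj₁ (proj₂ (proj₂ edge₁))
    a₁b₁ = proj₂ (proj₂ (proj₂ edge₁))
    a₂ = proj₁ edge₂
    b₂ = proj₁ (proj₂ edge₂)
    ca₂ = proj₁ (proj₂ (proj₂ edge₂))
    a₂b₂ = proj₂ (proj₂ (proj₂ edge₂))

K₂-split-of-obstruction : ∀ {G k c i} → MinimalObstruction G ∞ k → HasType G c i → 1 ≤ i → i + 2 ≤ c →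
  Σ Graph λ H → G ≅ (K₂ ⊕ H)
K₂-split-of-obstruction {G} (_ , ¬polar , proper) t 1≤i i+2≤c =
  let v , isolated = isolated-vertex {G} t 1≤i
      _ , _ , _ , _ , a₁b₁ , a₂b₂ , ¬a₁a₂ = nontrivial-components {G} t i+2≤c
      _ , _ , K₂-ab = K₂-component ¬polar (ProperInducedPolar⇒DeletionsPolar proper) (connected? {G} t)
                                   v isolated a₁b₁ a₂b₂ ¬a₁a₂
  in K₂-split K₂-ab

theorem9 : (j k p : ℕ) → 1 ≤ p → p ≤ k ∸ j → (G : Graph) →
    (MinimalObstruction G ∞ (fin k) × HasType G (k ∸ j + 2) p) ⇔
    Σ Graph (λ G′ → MinimalObstruction G′ ∞ (fin (k ∸ 1)) ×
                    HasType G′ (k ∸ j + 1) p ×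
                    Polar G′ (fin 1) (fin k) ×
                    (G ≅ (K₂ ⊕ G′)))
theorem9 j zero p 1≤p p≤0∸j G = contradiction (ℕ.≤-trans 1≤p (subst (p ≤_) (ℕ.0∸n≡0 j) p≤0∸j)) λ ()
theorem9 j (suc k) p 1≤p p≤c G = mk⇔ forward backward
  where
  c = suc k ∸ j
  c+2≡1+[c+1] : c + 2 ≡ suc (c + 1)
  c+2≡1+[c+1] = ℕ.+-suc c 1
  Decomposition : Graph → Set
  Decomposition H = MinimalObstruction H ∞ (fin k) × HasType H (c + 1) p × Polar H (fin 1) (fin (suc k)) × (G ≅ (K₂ ⊕ H))
  forward : MinimalObstruction G ∞ (fin (suc k)) × HasType G (c + 2) p → Σ Graph Decomposition
  forward (obstruction , type) =
    let H , G≅K₂⊕H = K₂-split-of-obstruction obstruction type 1≤p (ℕ.+-monoˡ-≤ 2 p≤c)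
        K₂⊕H-obstruction = MinimalObstruction-≅ G≅K₂⊕H obstruction
    in H , K₂⊕-obstruction⁻ K₂⊕H-obstruction ,
       K₂⊕.HasType-K₂⊕⁻ H (subst (λ c′ → HasType (K₂ ⊕ H) c′ p) c+2≡1+[c+1] (HasType-≅ G≅K₂⊕H type)) ,
       K₂⊕-obstruction⇒one-part K₂⊕H-obstruction , G≅K₂⊕H
  backward : Σ Graph Decomposition → MinimalObstruction G ∞ (fin (suc k)) × HasType G (c + 2) p
  backward (H , obstruction , type , one-part , G≅K₂⊕H) =
    MinimalObstruction-≅ (≅-sym G≅K₂⊕H) (K₂⊕-obstruction obstruction one-part) ,
    HasType-≅ (≅-sym G≅K₂⊕H)
      (subst (λ c′ → HasType (K₂ ⊕ H) c′ p) (≡.sym c+2≡1+[c+1]) (K₂⊕.HasType-K₂⊕ H type))
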